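{- Let $G$ be a connected $3K_1$-free graph and let $u,v$ be distinct vertices of $G$. Then $G$ has a Hamiltonian path with end-vertices $u$ and $v$ if and only if all of the following hold: (a) neither $u$ nor $v$ is an articulation point of $G$; (b) for every articulation point $x$ of $G$, the vertices $u$ and $v$ belong to different connected components of $G-\{x\}$; (c) $\{u,v\}$ is not a vertex cut of size two in $G$.
   Context: Graphs are finite, simple and undirected. $3K_1$-free means no independent set of size 3. A vertex cut is a set $A\subset V(G)$ such that $G-A$ is disconnected; an articulation point is a vertex $x$ such that $\{x\}$ is a vertex cut. A Hamiltonian path is a path containing all vertices of $G$. -}

module Defs where

open import Data.Nat using (ℕ)
open import Data.Fin using (Fin)
open import Data.Bool using (Bool; T)
open import Data.List using (List; head; last)
open import Data.Maybe using (just)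
open import Data.Product using (Σ; _×_; ∃-syntax)
open import Data.Empty using (⊥)
open import Relation.Nullary using (¬_)
open import Relation.Binary.PropositionalEquality using (_≡_; _≢_)
open import Data.List.Membership.Propositional using (_∈_)
open import Data.List.Relation.Unary.Unique.Propositional using (Unique)
open import Data.List.Relation.Unary.Linked using (Linked)

record Graph (n : ℕ) : Set where
  field
    adj    : Fin n → Fin n → Bool
    sym    : ∀ a b → adj a b ≡ adj b a
    irrefl : ∀ a → adj a a ≡ Data.Bool.false

open Graph public

module _ {n : ℕ} (G : Graph n) where

  Adj : Fin n → Fin n → Set
  Adj a b = T (adj G a b)

  ThreeK1Free : Set
  ThreeK1Free = ¬ (Σ (Fin n) λ a → Σ (Fin n) λ b → Σ (Fin n) λ c →
                    a ≢ b × a ≢ c × b ≢ c ×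
                    ¬ Adj a b × ¬ Adj a c × ¬ Adj b c)

  data WalkIn (S : Fin n → Set) : Fin n → Fin n → Set where
    here : ∀ {a} → S a → WalkIn S a a
    step : ∀ {a c b} → S a → Adj a c → WalkIn S c b → WalkIn S a b

  Outside : (Fin n → Set) → Fin n → Set
  Outside A w = ¬ A w

  ConnectedIn : (Fin n → Set) → Fin n → Fin n → Set
  ConnectedIn A a b = WalkIn (Outside A) a b

  Connected : Set
  Connected = ∀ a b → WalkIn (λ _ → Data.Unit.⊤) a b
    where import Data.Unit

  IsVertexCut : (Fin n → Set) → Set
  IsVertexCut A = Σ (Fin n) λ a → Σ (Fin n) λ b →
                    ¬ A a × ¬ A b × ¬ ConnectedIn A a b

  IsArticulationPoint : Fin n → Set
  IsArticulationPoint x = IsVertexCut (λ w → w ≡ x)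

  DifferentComponentsAfterRemoving : Fin n → Fin n → Fin n → Set
  DifferentComponentsAfterRemoving x u v =
    u ≢ x × v ≢ x × ¬ ConnectedIn (λ w → w ≡ x) u v

  Pair : Fin n → Fin n → Fin n → Set
  Pair u v w = (w ≡ u) Data.Sum.⊎ (w ≡ v)
    where import Data.Sum

  IsHamiltonianPath : List (Fin n) → Set
  IsHamiltonianPath p = Unique p × (∀ w → w ∈ p) × Linked Adj p

  HamiltonianPathBetween : Fin n → Fin n → Set
  HamiltonianPathBetween u v =
    Σ (List (Fin n)) λ p → IsHamiltonianPath p × head p ≡ just u × last p ≡ just v

-- Necessity: removing one or both end-vertices of a Hamiltonian u–v path leaves a path through
-- all remaining vertices, and removing an inner vertex x leaves one subpath ending in u and one
-- ending in v, so a u–v walk avoiding x would reconnect G − x.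
--
-- Sufficiency: lengthen a u–v path p while it misses some vertex. If p is the edge uv, (a) gives
-- outside neighbours of u and of v and (c) joins them outside {u, v}: a detour from u to v.
-- Otherwise (c) gives a vertex r outside p adjacent to an inner vertex x of p. If r has another
-- neighbour c on p, then r can be spliced in: by 3K₁-freeness r is adjacent to the successor of
-- c or of x, or these two successors are adjacent and the path can be rotated around r.
-- Otherwise 3K₁-freeness forces p − x to be a clique; then u ∼ v, so x is no articulation point
-- by (b), and a walk from r back to p avoiding x is a detour that the clique lets us splice in.
-- Every step argues by contradiction, so this yields ¬¬ of a Hamiltonian path, which suffices
-- because having one is decidable.
module Submission where

open import Data.Bool using (T)
open import Data.Empty using (⊥; ⊥-elim)
open import Data.Fin using (Fin; _≟_)
open import Data.Fin.Properties using (all?; ¬∀⟶∃¬; pigeonhole)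
import Data.Fin as Fin
open import Data.List
  using (List; []; _∷_; _++_; [_]; reverse; head; last; length; allFin; concat; map; lookup)
open import Data.List.Properties using (++-assoc; ++-identityʳ; reverse-++; unfold-reverse; length-++)
open import Data.List.Membership.Propositional using (_∈_; _∉_; lose)
open import Data.List.Membership.Propositional.Properties
  using (∈-++⁺ˡ; ∈-++⁺ʳ; ∈-++⁻; ∈-∃++; ∈-allFin; ∈-map⁺; ∈-concat⁺′; ∈-lookup)
open import Data.List.Relation.Unary.Any using (here; there)
import Data.List.Relation.Unary.Any as Any
open import Data.List.Relation.Unary.Any.Properties using (reverse⁺; reverse⁻)
open import Data.List.Relation.Unary.All using ([])
import Data.List.Relation.Unary.All as All
open import Data.List.Relation.Unary.All.Properties.Core using (¬Any⇒All¬)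
open import Data.List.Relation.Unary.AllPairs using ([]; _∷_)
open import Data.List.Relation.Unary.Linked using (Linked; [-]; _∷_; linked?)
open import Data.List.Relation.Unary.Unique.Propositional using (Unique)
import Data.List.Relation.Unary.Unique.Propositional.Properties as Unique
open import Data.List.Relation.Binary.Disjoint.Propositional using (Disjoint)
open import Data.List.Relation.Binary.Permutation.Propositional
  using (_↭_; ↭-refl; ↭-sym; ↭-trans; ↭-reflexive; prep; ↭⇒↭ₛ)
open import Data.List.Relation.Binary.Permutation.Propositional.Properties
  using (++⁺ˡ; ++⁺ʳ; ++-comm; ↭-reverse; ↭-length; ∈-resp-↭)
import Data.List.Relation.Binary.Permutation.Setoid.Properties as PermutationSetoid
open import Data.Maybe using (just)
open import Data.Maybe.Properties using (≡-dec)
open import Data.Nat using (ℕ; zero; suc; _+_; _≤_; _<_; _≤?_; z≤n; s≤s)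
open import Data.Nat.Properties using (≤-trans; ≰⇒>; +-suc; +-monoʳ-≤; m≤m+n; m<m+n; n≮n)
open import Data.Product using (∃-syntax; _×_; _,_; proj₂; swap)
open import Data.Sum using (_⊎_; inj₁; inj₂)
open import Function using (_∘_)
open import Function.Bundles using (_⇔_; mk⇔)
open import Relation.Binary.PropositionalEquality
  using (_≡_; _≢_; refl; cong; subst; trans) renaming (sym to ≡-sym)
open import Relation.Binary.PropositionalEquality.Properties using (setoid)
open import Relation.Nullary using (¬_; Dec; yes; no)
open import Relation.Nullary.Decidable using (T?; decidable-stable; _×-dec_)
open import Relation.Unary using (Decidable)
open import Defs

∉-∈⇒≢ : ∀ {A : Set} {x y : A} {l : List A} → x ∉ l → y ∈ l → x ≢ y
∉-∈⇒≢ x∉l y∈l refl = x∉l y∈l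

module _ {A : Set} where

  Unique-resp-↭ : {xs ys : List A} → xs ↭ ys → Unique xs → Unique ys
  Unique-resp-↭ σ = PermutationSetoid.Unique-resp-↭ (setoid A) (↭⇒↭ₛ σ)

  Unique-reverse : {xs : List A} → Unique xs → Unique (reverse xs)
  Unique-reverse {xs} = Unique-resp-↭ (↭-sym (↭-reverse xs))

  Unique-++⁻ʳ : ∀ (xs : List A) {ys} → Unique (xs ++ ys) → Unique ys
  Unique-++⁻ʳ []       u       = u
  Unique-++⁻ʳ (_ ∷ xs) (_ ∷ u) = Unique-++⁻ʳ xs u

  Unique-++⇒∉ : ∀ (xs : List A) {ys x} → Unique (xs ++ ys) → x ∈ xs → x ∉ ys
  Unique-++⇒∉ (_ ∷ xs) (x∉ ∷ _) (here refl) x∈ys = All.lookup x∉ (∈-++⁺ʳ xs x∈ys) refl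
  Unique-++⇒∉ (_ ∷ xs) (_ ∷ u)  (there x∈xs) = Unique-++⇒∉ xs u x∈xs

  Unique-++-∷⇒≢ : ∀ (xs : List A) {y ys z} → Unique (xs ++ y ∷ ys) → z ∈ ys → y ≢ z
  Unique-++-∷⇒≢ xs u = ∉-∈⇒≢ (Unique.Unique[x∷xs]⇒x∉xs (Unique-++⁻ʳ xs u))

  reverse-split : ∀ (xs ys : List A) {x} → reverse (xs ++ x ∷ ys) ≡ reverse ys ++ x ∷ reverse xs
  reverse-split xs ys {x} =
    trans (reverse-++ xs (x ∷ ys))
          (trans (cong (_++ reverse xs) (unfold-reverse x ys)) (++-assoc (reverse ys) [ x ] (reverse xs)))

Unique-length≤ : ∀ {n} {xs : List (Fin n)} → Unique xs → length xs ≤ n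
Unique-length≤ {n} {xs} u with length xs ≤? n
... | yes ≤n = ≤n
... | no ≰n with pigeonhole (≰⇒> ≰n) (lookup xs)
...   | i , j , i<j , same = ⊥-elim (distinct u i<j same)
  where
  distinct : ∀ {xs : List (Fin n)} → Unique xs → ∀ {i j} → i Fin.< j → lookup xs i ≢ lookup xs j
  distinct {_ ∷ _} (x∉ ∷ _) {Fin.zero}  {Fin.suc j} _         = All.lookup x∉ (∈-lookup j)
  distinct {_ ∷ _} (_ ∷ u)  {Fin.suc i} {Fin.suc j} (s≤s i<j) = distinct u i<j

module _ {n : ℕ} (G : Graph n) where

  private
    V : Set
    V = Fin n

    variable
      a b c d r s t x y z : V
      l m p : List V
      S : V → Set

  open import Data.List.Membership.DecPropositional (_≟_ {n}) using (_∈?_)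
  open import Data.List.Relation.Unary.Unique.DecPropositional (_≟_ {n}) using (unique?)

  Adj-sym : Adj G a b → Adj G b a
  Adj-sym {a} {b} = subst T (sym G a b)

  Adj? : ∀ a b → Dec (Adj G a b)
  Adj? a b = T? (adj G a b)

  Pair⇒∈ : Pair G a b z → z ∈ a ∷ b ∷ []
  Pair⇒∈ (inj₁ refl) = here refl
  Pair⇒∈ (inj₂ refl) = there (here refl)

  ∈⇒Pair : z ∈ a ∷ b ∷ [] → Pair G a b z
  ∈⇒Pair (here z≡a)         = inj₁ z≡a
  ∈⇒Pair (there (here z≡b)) = inj₂ z≡b

  WalkIn-source : WalkIn G S a b → S a
  WalkIn-source (here sa)     = sa
  WalkIn-source (step sa _ _) = sa

  WalkIn-target : WalkIn G S a b → S b
  WalkIn-target (here sb)    = sb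
  WalkIn-target (step _ _ w) = WalkIn-target w

  WalkIn-trans : WalkIn G S a b → WalkIn G S b c → WalkIn G S a c
  WalkIn-trans (here _)      w′ = w′
  WalkIn-trans (step sa e w) w′ = step sa e (WalkIn-trans w w′)

  WalkIn-sym : WalkIn G S a b → WalkIn G S b a
  WalkIn-sym (here sa)     = here sa
  WalkIn-sym (step sa e w) = WalkIn-trans (WalkIn-sym w) (step (WalkIn-source w) (Adj-sym e) (here sa))

  record Entry (S Q : V → Set) (a : V) : Set where
    constructor entry
    field
      {outside inside} : V
      outside∉Q : ¬ Q outside
      inside∈Q  : Q inside
      inside∈S  : S inside
      edge      : Adj G outside inside
      approach  : WalkIn G (λ z → S z × ¬ Q z) a outside

  first-entry : ∀ {Q} → Decidable Q → WalkIn G S a b → ¬ Q a → Q b → Entry S Q a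
  first-entry Q? (here _) a∉Q b∈Q = ⊥-elim (a∉Q b∈Q)
  first-entry Q? (step {c = c} sa e w) a∉Q b∈Q with Q? c
  ... | yes c∈Q = entry a∉Q c∈Q (WalkIn-source w) e (here (sa , a∉Q))
  ... | no c∉Q with first-entry Q? w c∉Q b∈Q
  ...   | entry o∉Q i∈Q i∈S e′ w′ = entry o∉Q i∈Q i∈S e′ (step (sa , a∉Q) e w′)

  infixr 5 _▸_
  data Path : V → List V → V → Set where
    stop : Path a [ a ] a
    _▸_  : Adj G a b → Path b l c → Path a (a ∷ l) c

  Path-source∈ : Path a l b → a ∈ l
  Path-source∈ stop    = here refl
  Path-source∈ (_ ▸ _) = here refl

  Path-target∈ : Path a l b → b ∈ l
  Path-target∈ stop    = here refl
  Path-target∈ (_ ▸ π) = there (Path-target∈ π)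

  Path-source≡ : Path a (x ∷ l) b → a ≡ x
  Path-source≡ stop    = refl
  Path-source≡ (_ ▸ _) = refl

  Path-tail : Path a (a ∷ x ∷ l) b → Path x (x ∷ l) b
  Path-tail (_ ▸ π) with Path-source≡ π
  ... | refl = π

  Path-uncons : Path a l b → ∃[ l′ ] l ≡ a ∷ l′
  Path-uncons stop              = [] , refl
  Path-uncons (_▸_ {l = l} _ _) = l , refl

  Path-head : Path a l b → head l ≡ just a
  Path-head stop    = refl
  Path-head (_ ▸ _) = refl

  Path-last : Path a l b → last l ≡ just b
  Path-last stop           = refl
  Path-last (_ ▸ stop)     = refl
  Path-last (_ ▸ e ▸ π)    = Path-last (e ▸ π)

  Path⇒Linked : Path a l b → Linked (Adj G) l
  Path⇒Linked stop        = [-]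
  Path⇒Linked (e ▸ stop)  = e ∷ [-]
  Path⇒Linked (e ▸ e′ ▸ π) = e ∷ Path⇒Linked (e′ ▸ π)

  Linked⇒Path : ∀ l → Linked (Adj G) l → head l ≡ just a → last l ≡ just b → Path a l b
  Linked⇒Path (_ ∷ [])     [-]      refl refl = stop
  Linked⇒Path (_ ∷ _ ∷ l) (e ∷ ln) refl ends = e ▸ Linked⇒Path (_ ∷ l) ln refl ends

  Path-++ : Path a l b → Adj G b c → Path c m d → Path a (l ++ m) d
  Path-++ stop    e π′ = e ▸ π′
  Path-++ (e ▸ π) f π′ = e ▸ Path-++ π f π′

  Path-reverse : Path a l b → Path b (reverse l) a
  Path-reverse stop = stop
  Path-reverse {a} (_▸_ {l = l} e π) =
    subst (λ l′ → Path _ l′ a) (≡-sym (unfold-reverse a l)) (Path-++ (Path-reverse π) (Adj-sym e) stop)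

  Path-split : ∀ P Q → Path a (P ++ x ∷ Q) c → Path a (P ++ [ x ]) x × Path x (x ∷ Q) c
  Path-split []          Q stop             = stop , stop
  Path-split []          Q (e ▸ π)          = stop , e ▸ π
  Path-split (_ ∷ [])    Q (e ▸ stop)       = e ▸ stop , stop
  Path-split (_ ∷ [])    Q (e ▸ e′ ▸ π)     = e ▸ stop , e′ ▸ π
  Path-split (_ ∷ y ∷ P) Q (e ▸ π) with Path-split (y ∷ P) Q π
  ... | π₁ , π₂ = e ▸ π₁ , π₂

  Path-join : ∀ P Q → Path a (P ++ [ x ]) x → Path x (x ∷ Q) c → Path a (P ++ x ∷ Q) c
  Path-join []          Q stop          π′ = π′
  Path-join (_ ∷ [])    Q (e ▸ stop)    π′ = e ▸ π′
  Path-join (_ ∷ y ∷ P) Q (e ▸ π)       π′ = e ▸ Path-join (y ∷ P) Q π π′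

  Path-snoc : Path a l b → ∃[ M ] l ≡ M ++ [ b ]
  Path-snoc stop = [] , refl
  Path-snoc {a} (_ ▸ π) with Path-snoc π
  ... | M , refl = a ∷ M , refl

  Path-reverse-split : ∀ P Q → Path a (P ++ x ∷ Q) b → Path b (reverse Q ++ x ∷ reverse P) a
  Path-reverse-split P Q π = subst (λ l → Path _ l _) (reverse-split P Q) (Path-reverse π)

  Path-prefix-reaches-source : ∀ P {Q} → Path a (P ++ Q) b → (∀ {z} → z ∈ P → S z) → c ∈ P → WalkIn G S c a
  Path-prefix-reaches-source (_ ∷ _) π inS (here refl) =
    subst (WalkIn G _ _) (≡-sym (Path-source≡ π)) (here (inS (here refl)))
  Path-prefix-reaches-source (_ ∷ y ∷ P) (e ▸ π) inS (there c∈P) =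
    WalkIn-trans w (step (WalkIn-target w) (Adj-sym e) (here (inS (here refl))))
    where w = Path-prefix-reaches-source (y ∷ P) π (inS ∘ there) c∈P

  Path-reaches-source : Path a l b → (∀ {z} → z ∈ l → S z) → c ∈ l → WalkIn G S c a
  Path-reaches-source {l = l} π =
    Path-prefix-reaches-source l (subst (λ l′ → Path _ l′ _) (≡-sym (++-identityʳ l)) π)

  record SimplePathIn (S : V → Set) (a b : V) : Set where
    constructor simple
    field
      {vertices} : List V
      path       : Path a vertices b
      unique     : Unique vertices
      inside     : ∀ {z} → z ∈ vertices → S z

  WalkIn⇒SimplePathIn : WalkIn G S a b → SimplePathIn S a b
  WalkIn⇒SimplePathIn (here sa) = simple stop ([] ∷ []) λ { (here refl) → sa }
  WalkIn⇒SimplePathIn {a = a} (step sa e w) with WalkIn⇒SimplePathIn w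
  ... | simple {l} π u inS with a ∈? l
  ...   | no a∉l = simple (e ▸ π) (¬Any⇒All¬ l a∉l ∷ u) λ { (here refl) → sa ; (there z∈l) → inS z∈l }
  ...   | yes a∈l with ∈-∃++ a∈l
  ...     | P , Q , refl = simple (proj₂ (Path-split P Q π)) (Unique-++⁻ʳ P u) (inS ∘ ∈-++⁺ʳ P)

  -- Necessity

  Covers : List V → Set
  Covers l = ∀ z → z ∈ l

  source-¬articulation : Path s p t → Unique p → Covers p → s ≢ t → ¬ IsArticulationPoint G s
  source-¬articulation stop _ _ s≢t _ = s≢t refl
  source-¬articulation {s} (_ ▸ π) (s∉l ∷ _) covers _ (a , b , a≢s , b≢s , ¬W) =
    ¬W (WalkIn-trans (reach a≢s) (WalkIn-sym (reach b≢s)))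
    where
    reach : z ≢ s → WalkIn G (λ z → ¬ z ≡ s) z _
    reach {z} z≢s with covers z
    ... | here z≡s  = ⊥-elim (z≢s z≡s)
    ... | there z∈l = Path-reaches-source π (λ z∈l z≡s → All.lookup s∉l z∈l (≡-sym z≡s)) z∈l

  ends-¬cut : Path s p t → Unique p → Covers p → ¬ IsVertexCut G (Pair G s t)
  ends-¬cut stop _ covers (a , _ , a∉ , _) with covers a
  ... | here a≡s = a∉ (inj₁ a≡s)
  ends-¬cut {s} {t = t} (_ ▸ π) (s∉ ∷ u) covers (a , b , a∉ , b∉ , ¬W) with Path-snoc π
  ... | M , refl = ¬W (WalkIn-trans (reach a∉) (WalkIn-sym (reach b∉)))
    where
    inM : ¬ Pair G s t z → z ∈ M
    inM {z} z∉ with covers z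
    ... | here z≡s = ⊥-elim (z∉ (inj₁ z≡s))
    ... | there z∈l with ∈-++⁻ M z∈l
    ...   | inj₁ z∈M         = z∈M
    ...   | inj₂ (here z≡t)  = ⊥-elim (z∉ (inj₂ z≡t))
    avoid : z ∈ M → ¬ Pair G s t z
    avoid z∈M (inj₁ refl) = All.lookup s∉ (∈-++⁺ˡ z∈M) refl
    avoid z∈M (inj₂ refl) = Unique-++⇒∉ M u z∈M (here refl)
    reach : ¬ Pair G s t z → WalkIn G (λ z → ¬ Pair G s t z) z _
    reach z∉ = Path-prefix-reaches-source M π avoid (inM z∉)

  -- Every vertex other than x reaches s along the path before x, or t along the path after x.
  articulation-separates : Path s p t → Unique p → Covers p → s ≢ x → IsArticulationPoint G x →
                           ¬ ConnectedIn G (λ z → z ≡ x) s t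
  articulation-separates {x = x} π u covers s≢x (a , b , a≢x , b≢x , ¬W) W with ∈-∃++ (covers x)
  ... | P , Q , refl = ¬W (WalkIn-trans (reach a≢x) (WalkIn-sym (reach b≢x)))
    where
    reach : z ≢ x → WalkIn G (λ z → ¬ z ≡ x) z _
    reach {z} z≢x with ∈-++⁻ P (covers z)
    ... | inj₁ z∈P = Path-prefix-reaches-source P π (λ z∈P z≡x → Unique-++⇒∉ P u z∈P (here z≡x)) z∈P
    ... | inj₂ (here z≡x) = ⊥-elim (z≢x z≡x)
    ... | inj₂ (there z∈Q) =
      WalkIn-trans (Path-prefix-reaches-source (reverse Q) (Path-reverse-split P Q π)
                      (λ z∈Q′ z≡x → Unique-++-∷⇒≢ P u (reverse⁻ z∈Q′) (≡-sym z≡x)) (reverse⁺ z∈Q))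
                   (WalkIn-sym W)

  necessity : ∀ {u v} → u ≢ v → HamiltonianPathBetween G u v →
              (¬ IsArticulationPoint G u × ¬ IsArticulationPoint G v) ×
              (∀ x → IsArticulationPoint G x → DifferentComponentsAfterRemoving G x u v) ×
              ¬ IsVertexCut G (Pair G u v)
  necessity {u} {v} u≢v (p , (up , covers , ln) , hd , ls) =
    (u-ok , v-ok) ,
    (λ x art → ≢-articulation u-ok art , ≢-articulation v-ok art ,
               articulation-separates π up covers (≢-articulation u-ok art) art) ,
    ends-¬cut π up covers
    where
    π = Linked⇒Path p ln hd ls
    u-ok = source-¬articulation π up covers u≢v
    v-ok = source-¬articulation (Path-reverse π) (Unique-reverse up) (reverse⁺ ∘ covers) (u≢v ∘ ≡-sym)
    ≢-articulation : ¬ IsArticulationPoint G z → IsArticulationPoint G x → z ≢ x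
    ≢-articulation ¬art art refl = ¬art art

  -- Deciding Hamiltonicity

  lists-up-to : ℕ → List (List V)
  lists-up-to zero    = [ [] ]
  lists-up-to (suc k) = [] ∷ concat (map (λ x → map (x ∷_) (lists-up-to k)) (allFin n))

  ∈-lists-up-to : ∀ k l → length l ≤ k → l ∈ lists-up-to k
  ∈-lists-up-to zero    []      _         = here refl
  ∈-lists-up-to (suc k) []      _         = here refl
  ∈-lists-up-to (suc k) (x ∷ l) (s≤s l≤k) =
    there (∈-concat⁺′ (∈-map⁺ (x ∷_) (∈-lists-up-to k l l≤k))
                      (∈-map⁺ (λ x → map (x ∷_) (lists-up-to k)) (∈-allFin x)))

  IsHamiltonianPath? : ∀ l → Dec (IsHamiltonianPath G l)
  IsHamiltonianPath? l = unique? l ×-dec all? (_∈? l) ×-dec linked? Adj? l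

  HamiltonianPathBetween? : ∀ u v → Dec (HamiltonianPathBetween G u v)
  HamiltonianPathBetween? u v
    with Any.any? (λ l → IsHamiltonianPath? l ×-dec ≡-dec _≟_ (head l) (just u)
                                               ×-dec ≡-dec _≟_ (last l) (just v))
                  (lists-up-to n)
  ... | yes found = yes (Any.satisfied found)
  ... | no ¬found = no λ (l , h@((ul , _) , _)) → ¬found (lose (∈-lists-up-to n l (Unique-length≤ ul)) h)

  -- Splicing detours into a path

  record Extension (a b : V) (p : List V) : Set where
    constructor extension
    field
      {vertices} : List V
      {new}      : V
      {others}   : List V
      path       : Path a vertices b
      unique     : Unique vertices
      grows      : vertices ↭ p ++ new ∷ others

  Extension-flip : Extension b a p → Extension a b p
  Extension-flip (extension {q} π u g) =
    extension (Path-reverse π) (Unique-reverse u) (↭-trans (↭-reverse q) g)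

  Extension-longer : (e : Extension a b p) → length p < length (Extension.vertices e)
  Extension-longer {p = p} (extension _ _ g) =
    subst (length p <_) (≡-sym (trans (↭-length g) (length-++ p))) (m<m+n (length p) (s≤s z≤n))

  record Detour (p : List V) (s t : V) : Set where
    constructor mkDetour
    field
      {start end} : V
      {rest}      : List V
      path        : Path start (start ∷ rest) end
      unique      : Unique (start ∷ rest)
      disjoint    : Disjoint (start ∷ rest) p
      enter       : Adj G s start
      exit        : Adj G end t

  detour : Path a l b → Unique l → Disjoint l p → Adj G s a → Adj G b t → Detour p s t
  detour π u dj e₁ e₂ with Path-uncons π
  ... | _ , refl = mkDetour π u dj e₁ e₂

  single-detour : r ∉ p → Adj G s r → Adj G r t → Detour p s t
  single-detour r∉p = mkDetour stop ([] ∷ []) λ { (here refl , r∈p) → r∉p r∈p }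

  walk-detour : WalkIn G S a b → (∀ {z} → S z → z ∉ p) → Adj G s a → Adj G b t → Detour p s t
  walk-detour w outside with WalkIn⇒SimplePathIn w
  ... | simple π u inS = detour π u (λ (z∈l , z∈p) → outside (inS z∈l) z∈p)

  -- R may be any rearrangement of the part of p after s; rotations rely on this.
  detour-extension : ∀ P {s} (d : Detour p s t) R →
                     Path a (P ++ s ∷ (Detour.start d ∷ Detour.rest d) ++ R) b →
                     P ++ s ∷ R ↭ p → Unique p → Extension a b p
  detour-extension P {s} (mkDetour {rest = X} _ uX dX _ _) R π σ u =
    extension π (Unique-resp-↭ (↭-sym grows) (Unique.++⁺ u uX (dX ∘ swap))) grows
    where
    grows = ↭-trans (++⁺ˡ P (prep s (++-comm (_ ∷ X) R)))
                    (↭-trans (↭-reflexive (≡-sym (++-assoc P (s ∷ R) (_ ∷ X)))) (++⁺ʳ (_ ∷ X) σ))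

  insert-detour : ∀ P Q → Path a (P ++ s ∷ t ∷ Q) b → P ++ s ∷ t ∷ Q ↭ p → Unique p →
                  Detour p s t → Extension a b p
  insert-detour {t = t} P Q π σ u d@(mkDetour πX _ _ e₁ e₂) with Path-split P (t ∷ Q) π
  ... | π₁ , π₂ = detour-extension P d (_ ∷ Q) (Path-join P _ π₁ (e₁ ▸ Path-++ πX e₂ (Path-tail π₂))) σ u

  -- The path a ⋯ s m ⋯ t b₁ ⋯ b becomes a ⋯ s X t ⋯ m b₁ ⋯ b.
  rotate-detour : ∀ P M Q {m b₁} → Path a (P ++ s ∷ m ∷ M ++ t ∷ b₁ ∷ Q) b →
                  P ++ s ∷ m ∷ M ++ t ∷ b₁ ∷ Q ↭ p → Unique p → Adj G m b₁ →
                  Detour p s t → Extension a b p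
  rotate-detour {s = s} {t = t} P M Q {m} {b₁} π σ u m∼b₁ d@(mkDetour πX _ _ e₁ e₂)
    with Path-split P (m ∷ M ++ t ∷ b₁ ∷ Q) π
  ... | π₁ , πs with Path-split (m ∷ M) (b₁ ∷ Q) (Path-tail πs)
  ...   | πm , πt =
    detour-extension P d R
      (Path-join P _ π₁ (e₁ ▸ Path-++ πX e₂ (Path-++ (Path-reverse πm) m∼b₁ (Path-tail πt)))) σ′ u
    where
    R = reverse (m ∷ M ++ [ t ]) ++ b₁ ∷ Q
    σ′ = ↭-trans (++⁺ˡ P (prep s (↭-trans (++⁺ʳ (b₁ ∷ Q) (↭-reverse (m ∷ M ++ [ t ])))
                                          (↭-reflexive (++-assoc (m ∷ M) [ t ] (b₁ ∷ Q))))))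
                 σ

  -- p, up to order, is traversed from a to b meeting c before x, and x is not the last vertex.
  record Before (a b c x : V) (p : List V) : Set where
    constructor before
    field
      P M : List V
      next : V
      Q : List V
      path : Path a (P ++ c ∷ M ++ x ∷ next ∷ Q) b
      perm : P ++ c ∷ M ++ x ∷ next ∷ Q ↭ p

  Before-resp-↭ : ∀ {p p′} → p ↭ p′ → Before a b c x p → Before a b c x p′
  Before-resp-↭ σ (before P M y Q π σ′) = before P M y Q π (↭-trans σ′ σ)

  Before-prefix : ∀ P Q → Path a (P ++ x ∷ Q) b → c ∈ P → x ≢ b → Before a b c x (P ++ x ∷ Q)
  Before-prefix P [] π _ x≢b with Path-split P [] π
  ... | _ , stop = ⊥-elim (x≢b refl)
  Before-prefix {x = x} {c = c} P (y ∷ Q) π c∈P _ with ∈-∃++ c∈P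
  ... | P₁ , M , refl = before P₁ M y Q (subst (λ l → Path _ l _) assoc π) (↭-reflexive (≡-sym assoc))
    where assoc = ++-assoc P₁ (c ∷ M) (x ∷ y ∷ Q)

  before-or-after : Path a p b → c ∈ p → x ∈ p → c ≢ x → x ≢ a → x ≢ b →
                    Before a b c x p ⊎ Before b a c x p
  before-or-after π c∈p x∈p c≢x x≢a x≢b with ∈-∃++ x∈p
  ... | P , Q , refl with ∈-++⁻ P c∈p
  ...   | inj₁ c∈P         = inj₁ (Before-prefix P Q π c∈P x≢b)
  ...   | inj₂ (here c≡x)  = ⊥-elim (c≢x c≡x)
  ...   | inj₂ (there c∈Q) =
    inj₂ (Before-resp-↭ (↭-trans (↭-reflexive (≡-sym (reverse-split P Q))) (↭-reverse (P ++ _ ∷ Q)))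
           (Before-prefix (reverse Q) (reverse P) (Path-reverse-split P Q π) (reverse⁺ c∈Q) x≢a))

  rotation-vertices : ∀ P M {Q m b₁} → P ++ c ∷ m ∷ M ++ x ∷ b₁ ∷ Q ↭ p → Unique p →
                      m ∈ p × b₁ ∈ p × m ≢ b₁ × m ≢ x × b₁ ≢ x
  rotation-vertices {c = c} P M σ u =
    ∈-resp-↭ σ (∈-++⁺ʳ P (there (here refl))) ,
    ∈-resp-↭ σ (∈-++⁺ʳ P (there (there (∈-++⁺ʳ M (there (here refl)))))) ,
    Unique-++-∷⇒≢ (c ∷ []) uL (∈-++⁺ʳ M (there (here refl))) ,
    Unique-++-∷⇒≢ (c ∷ []) uL (∈-++⁺ʳ M (here refl)) ,
    Unique-++-∷⇒≢ (c ∷ _ ∷ M) uL (here refl) ∘ ≡-sym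
    where
    uL = Unique-++⁻ʳ P (Unique-resp-↭ (↭-sym σ) u)

  CliqueWithout : V → List V → Set
  CliqueWithout x p = ∀ {c c′} → c ∈ p → c′ ∈ p → c ≢ x → c′ ≢ x → c ≢ c′ → Adj G c c′

  clique-extension-before : Before a b y x p → Unique p → CliqueWithout x p → Detour p y x → Extension a b p
  clique-extension-before (before P [] z Q π σ) u _ d = insert-detour P (z ∷ Q) π σ u d
  clique-extension-before (before P (m ∷ M) b₁ Q π σ) u clique d with rotation-vertices P M σ u
  ... | m∈p , b₁∈p , m≢b₁ , m≢x , b₁≢x = rotate-detour P M Q π σ u (clique m∈p b₁∈p m≢x b₁≢x m≢b₁) d

  clique-extension : Path a p b → Unique p → CliqueWithout x p → x ∈ p → x ≢ a → x ≢ b →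
                     y ∈ p → y ≢ x → Detour p y x → Extension a b p
  clique-extension π u clique x∈p x≢a x≢b y∈p y≢x d with before-or-after π y∈p x∈p y≢x x≢a x≢b
  ... | inj₁ β = clique-extension-before β u clique d
  ... | inj₂ β = Extension-flip (clique-extension-before β u clique d)

  -- Sufficiency in 3K₁-free graphs

  module _ (3K₁-free : ThreeK1Free G) where

    non-neighbours-adjacent : r ≢ a → r ≢ b → a ≢ b → ¬ Adj G r a → ¬ Adj G r b → Adj G a b
    non-neighbours-adjacent {r} {a} {b} r≢a r≢b a≢b r≁a r≁b with Adj? a b
    ... | yes a∼b = a∼b
    ... | no a≁b  = ⊥-elim (3K₁-free (r , a , b , r≢a , r≢b , a≢b , r≁a , r≁b , a≁b))

    chord-extension-before : Before a b c x p → Unique p → r ∉ p → Adj G r x → Adj G r c → Extension a b p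
    chord-extension-before (before P [] y Q π σ) u r∉p r∼x r∼c =
      insert-detour P (y ∷ Q) π σ u (single-detour r∉p (Adj-sym r∼c) r∼x)
    chord-extension-before {c = c} {x} {r = r} (before P (m ∷ M) b₁ Q π σ) u r∉p r∼x r∼c
      with Adj? r m | Adj? r b₁
    ... | yes r∼m | _ = insert-detour P (M ++ x ∷ b₁ ∷ Q) π σ u (single-detour r∉p (Adj-sym r∼c) r∼m)
    ... | no _ | yes r∼b₁ =
      insert-detour (P ++ c ∷ m ∷ M) Q (subst (λ l → Path _ l _) assoc π) (subst (_↭ _) assoc σ) u
                    (single-detour r∉p (Adj-sym r∼x) r∼b₁)
      where assoc = ≡-sym (++-assoc P (c ∷ m ∷ M) (x ∷ b₁ ∷ Q))
    ... | no r≁m | no r≁b₁ with rotation-vertices P M σ u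
    ...   | m∈p , b₁∈p , m≢b₁ , _ =
      rotate-detour P M Q π σ u (non-neighbours-adjacent (∉-∈⇒≢ r∉p m∈p) (∉-∈⇒≢ r∉p b₁∈p) m≢b₁ r≁m r≁b₁)
                    (single-detour r∉p (Adj-sym r∼c) r∼x)

    chord-extension : Path a p b → Unique p → r ∉ p → x ∈ p → x ≢ a → x ≢ b → Adj G r x →
                      c ∈ p → c ≢ x → Adj G r c → Extension a b p
    chord-extension π u r∉p x∈p x≢a x≢b r∼x c∈p c≢x r∼c with before-or-after π c∈p x∈p c≢x x≢a x≢b
    ... | inj₁ β = chord-extension-before β u r∉p r∼x r∼c
    ... | inj₂ β = Extension-flip (chord-extension-before β u r∉p r∼x r∼c)

    ¬chord⇒clique : ¬ Extension a b p → Path a p b → Unique p → r ∉ p → x ∈ p → x ≢ a → x ≢ b →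
                    Adj G r x → CliqueWithout x p
    ¬chord⇒clique {p = p} {r = r} {x = x} ¬ext π u r∉p x∈p x≢a x≢b r∼x c∈p c′∈p c≢x c′≢x c≢c′ =
      non-neighbours-adjacent (∉-∈⇒≢ r∉p c∈p) (∉-∈⇒≢ r∉p c′∈p) c≢c′ (no-chord c∈p c≢x) (no-chord c′∈p c′≢x)
      where
      no-chord : ∀ {c} → c ∈ p → c ≢ x → ¬ Adj G r c
      no-chord c∈p c≢x r∼c = ¬ext (chord-extension π u r∉p x∈p x≢a x≢b r∼x c∈p c≢x r∼c)

    module Sufficiency (u v : V) (u≢v : u ≢ v)
      (u-ok : ¬ IsArticulationPoint G u) (v-ok : ¬ IsArticulationPoint G v)
      (separated : ∀ x → IsArticulationPoint G x → DifferentComponentsAfterRemoving G x u v)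
      (¬cut : ¬ IsVertexCut G (Pair G u v)) where

      extendable-edge : ∀ {w} → Path u (u ∷ v ∷ []) v → Unique (u ∷ v ∷ []) → w ∉ u ∷ v ∷ [] →
                        ¬ ¬ Extension u v (u ∷ v ∷ [])
      extendable-edge {w} π up w∉p ¬ext =
        u-ok (v , w , u≢v ∘ ≡-sym , w∉p ∘ here , λ W → v-ok (u , w , u≢v , w∉p ∘ there ∘ here , λ W′ →
          bridge (neighbour-of-v W) (neighbour-of-u W′)))
        where
        uv = u ∷ v ∷ []
        neighbour-of-v : ConnectedIn G (_≡ u) v w → ∃[ r ] r ∉ uv × Adj G r v
        neighbour-of-v W with first-entry (_∈? uv) (WalkIn-sym W) w∉p (there (here refl))
        ... | entry _   (here x≡u)         x≢u _   _ = ⊥-elim (x≢u x≡u)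
        ... | entry r∉p (there (here refl)) _  r∼v _ = _ , r∉p , r∼v
        neighbour-of-u : ConnectedIn G (_≡ v) u w → ∃[ r ] r ∉ uv × Adj G r u
        neighbour-of-u W with first-entry (_∈? uv) (WalkIn-sym W) w∉p (here refl)
        ... | entry r∉p (here refl)        _   r∼u _ = _ , r∉p , r∼u
        ... | entry _   (there (here x≡v)) x≢v _   _ = ⊥-elim (x≢v x≡v)
        bridge : ∃[ r ] r ∉ uv × Adj G r v → ∃[ r ] r ∉ uv × Adj G r u → ⊥
        bridge (r₁ , r₁∉p , r₁∼v) (r₂ , r₂∉p , r₂∼u) =
          ¬cut (r₂ , r₁ , r₂∉p ∘ Pair⇒∈ , r₁∉p ∘ Pair⇒∈ , λ W →
            ¬ext (insert-detour [] [] π ↭-refl up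
                   (walk-detour W (λ z∉ → z∉ ∘ ∈⇒Pair) (Adj-sym r₂∼u) r₁∼v)))

      extendable-through : ∀ {p w y} → Path u p v → Unique p → w ∉ p → y ∈ p → y ≢ u → y ≢ v →
                           ¬ ¬ Extension u v p
      extendable-through {p} {w} {y} π up w∉p y∈p y≢u y≢v ¬ext =
        ¬cut (w , y , w∉p ∘ end∈p , y∉uv , λ W → attach (first-entry (_∈? p) W w∉p y∈p))
        where
        end∈p : Pair G u v z → z ∈ p
        end∈p (inj₁ refl) = Path-source∈ π
        end∈p (inj₂ refl) = Path-target∈ π
        y∉uv : ¬ Pair G u v y
        y∉uv (inj₁ y≡u) = y≢u y≡u
        y∉uv (inj₂ y≡v) = y≢v y≡v
        attach : Entry (λ z → ¬ Pair G u v z) (_∈ p) w → ⊥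
        attach (entry {r} {x} r∉p x∈p x∉uv r∼x _) =
          x-ok (r , u , ∉-∈⇒≢ r∉p x∈p , x≢u ∘ ≡-sym ,
                λ W → reroute (first-entry (_∈? p) W r∉p (Path-source∈ π)))
          where
          x≢u = x∉uv ∘ inj₁
          x≢v = x∉uv ∘ inj₂
          clique = ¬chord⇒clique ¬ext π up r∉p x∈p x≢u x≢v r∼x
          x-ok : ¬ IsArticulationPoint G x
          x-ok art with separated x art
          ... | u≢x , v≢x , ¬W =
            ¬W (step u≢x (clique (Path-source∈ π) (Path-target∈ π) u≢x v≢x u≢v) (here v≢x))
          reroute : Entry (λ z → ¬ z ≡ x) (_∈ p) r → ⊥
          reroute (entry y₁∉p y₂∈p y₂≢x y₁∼y₂ approach) =
            ¬ext (clique-extension π up clique x∈p x≢u x≢v y₂∈p y₂≢x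
                   (walk-detour (WalkIn-sym approach) proj₂ (Adj-sym y₁∼y₂) r∼x))

      extendable : ∀ {p w} → Path u p v → Unique p → w ∉ p → ¬ ¬ Extension u v p
      extendable stop             _  _   = ⊥-elim (u≢v refl)
      extendable (e ▸ stop)       up w∉p = extendable-edge (e ▸ stop) up w∉p
      extendable π@(_ ▸ _ ▸ π′)   up w∉p =
        extendable-through π up w∉p (there (here refl)) (Unique-++-∷⇒≢ [] up (here refl) ∘ ≡-sym)
                           (Unique-++-∷⇒≢ (u ∷ []) up (Path-target∈ π′))

      ¬¬hamiltonian : ∀ {p} k → n ≤ k + length p → Path u p v → Unique p → ¬ ¬ HamiltonianPathBetween G u v
      ¬¬hamiltonian {p} k bound π up ¬ham with all? (_∈? p)
      ... | yes covers = ¬ham (p , (up , covers , Path⇒Linked π) , Path-head π , Path-last π)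
      ... | no ¬covers = extendable π up (proj₂ (¬∀⟶∃¬ n (_∈ p) (_∈? p) ¬covers)) (grow k bound)
        where
        grow : ∀ k → n ≤ k + length p → ¬ Extension u v p
        grow zero    bound e =
          n≮n _ (≤-trans (Extension-longer e) (≤-trans (Unique-length≤ (Extension.unique e)) bound))
        grow (suc k) bound e = ¬¬hamiltonian k bound′ (Extension.path e) (Extension.unique e) ¬ham
          where
          bound′ = ≤-trans bound (subst (_≤ k + length (Extension.vertices e)) (+-suc k (length p))
                                        (+-monoʳ-≤ k (Extension-longer e)))

      hamiltonian : Connected G → HamiltonianPathBetween G u v
      hamiltonian connected with WalkIn⇒SimplePathIn (connected u v)
      ... | simple π up _ =
        decidable-stable (HamiltonianPathBetween? u v) (¬¬hamiltonian n (m≤m+n n _) π up)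

theorem8 : {n : ℕ} (G : Graph n) → Connected G → ThreeK1Free G →
           (u v : Fin n) → u ≢ v →
           HamiltonianPathBetween G u v ⇔
             ((¬ IsArticulationPoint G u × ¬ IsArticulationPoint G v) ×
              (∀ x → IsArticulationPoint G x → DifferentComponentsAfterRemoving G x u v) ×
              ¬ IsVertexCut G (Pair G u v))
theorem8 G connected 3K₁-free u v u≢v =
  mk⇔ (necessity G u≢v)
      (λ ((u-ok , v-ok) , separated , ¬cut) →
         Sufficiency.hamiltonian G 3K₁-free u v u≢v u-ok v-ok separated ¬cut connected)
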